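{- Let $G$ be a connected graph with $2$-connected components (blocks) $G_1,\dots,G_l$. Then $G$ is $k$-contractible to a cactus if and only if there are nonnegative integers $k_1,\dots,k_l$ with $\sum_{i=1}^l k_i\le k$ such that each $G_i$ is $k_i$-contractible to a cactus.
   Context: A cactus is a connected graph in which every edge lies in at most one cycle. A graph is $k$-contractible to a cactus if at most $k$ edge contractions turn it into a cactus (contracting $uv$ replaces $u,v$ by a single vertex adjacent to $N(u)\cup N(v)\setminus\{u,v\}$). -}

module Defs where

open import Data.Nat using (ℕ; zero; suc; _+_; _≤_)
open import Data.Nat.DivMod using (_mod_)
open import Data.Fin using (Fin; toℕ) renaming (zero to fzero; suc to fsuc)
open import Data.Bool using (Bool; true; false)
open import Data.Product using (Σ; ∃; _×_; _,_)
open import Data.Sum using (_⊎_)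
open import Data.Unit using (⊤)
open import Relation.Binary.PropositionalEquality using (_≡_; _≢_)

record Graph (n : ℕ) : Set where
  field
    adj    : Fin n → Fin n → Bool
    sym    : ∀ x y → adj x y ≡ adj y x
    irrefl : ∀ x → adj x x ≡ false
open Graph public

Adj : ∀ {n} → Graph n → Fin n → Fin n → Set
Adj G x y = adj G x y ≡ true

VSet : ℕ → Set₁
VSet n = Fin n → Set

_⊆_ : ∀ {n} → VSet n → VSet n → Set
S ⊆ T = ∀ x → S x → T x

_≐_ : ∀ {n} → VSet n → VSet n → Set
S ≐ T = (S ⊆ T) × (T ⊆ S)

Image : ∀ {m n} → (Fin m → Fin n) → VSet n
Image e x = ∃ λ a → e a ≡ x

data Reach {n} (G : Graph n) (P : VSet n) : Fin n → Fin n → Set where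
  here  : ∀ {x} → P x → Reach G P x x
  there : ∀ {x z y} → P x → Adj G x z → Reach G P z y → Reach G P x y

ConnectedOn : ∀ {n} → Graph n → VSet n → Set
ConnectedOn G S = (∃ λ x → S x) × (∀ x y → S x → S y → Reach G S x y)

Connected : ∀ {n} → Graph n → Set
Connected G = ConnectedOn G (λ _ → ⊤)

NonseparableOn : ∀ {n} → Graph n → VSet n → Set
NonseparableOn G S =
  ConnectedOn G S ×
  (∀ v x y → S v → S x → S y → x ≢ v → y ≢ v →
     Reach G (λ z → S z × z ≢ v) x y)

IsBlock : ∀ {n} → Graph n → VSet n → Set₁
IsBlock G S = NonseparableOn G S × (∀ S' → S ⊆ S' → NonseparableOn G S' → S' ⊆ S)

IsBlockEmbedding : ∀ {n m} → Graph n → Graph m → (Fin m → Fin n) → Set₁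
IsBlockEmbedding G B e =
  (∀ a b → e a ≡ e b → a ≡ b) ×
  (∀ a b → adj B a b ≡ adj G (e a) (e b)) ×
  IsBlock G (Image e)

next : ∀ {r} → Fin (suc r) → Fin (suc r)
next {r} i = suc (toℕ i) mod (suc r)

record Cycle {n} (G : Graph n) : Set where
  field
    r      : ℕ
    long   : 2 ≤ r
    c      : Fin (suc r) → Fin n
    inj    : ∀ i j → c i ≡ c j → i ≡ j
    edges  : ∀ i → Adj G (c i) (c (next i))

OnCycle : ∀ {n} {G : Graph n} → Cycle G → Fin n → Fin n → Set
OnCycle C a b = ∃ λ i →
  (Cycle.c C i ≡ a × Cycle.c C (next i) ≡ b) ⊎ (Cycle.c C i ≡ b × Cycle.c C (next i) ≡ a)

-- cactus: connected, every edge lies on at most one cycle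
-- (two cycles sharing an edge have the same edge set, i.e. are the same cycle).
Cactus : ∀ {n} → Graph n → Set
Cactus G = Connected G ×
  (∀ (C D : Cycle G) a b → Adj G a b → OnCycle C a b → OnCycle D a b →
     ∀ x y → (OnCycle C x y → OnCycle D x y) × (OnCycle D x y → OnCycle C x y))

-- H is (a copy of) the graph obtained from G by contracting the edge uv:
-- f identifies exactly u and v, is onto, and H's edges are the images of
-- G's edges between distinct image vertices.
Contraction : ∀ {n m} → Graph n → Graph m → Fin n → Fin n → Set
Contraction {n} {m} G H u v =
  Adj G u v ×
  (Σ (Fin n → Fin m) λ f →
     (∀ a → ∃ λ x → f x ≡ a) ×
     f u ≡ f v ×
     (∀ x y → f x ≡ f y → x ≡ y ⊎ ((x ≡ u ⊎ x ≡ v) × (y ≡ u ⊎ y ≡ v))) ×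
     (∀ a b → (Adj H a b → a ≢ b × (∃ λ x → ∃ λ y → f x ≡ a × f y ≡ b × Adj G x y))
            × (a ≢ b × (∃ λ x → ∃ λ y → f x ≡ a × f y ≡ b × Adj G x y) → Adj H a b)))

data KContractible : ∀ {n} → ℕ → Graph n → Set where
  done : ∀ {n k} {G : Graph n} → Cactus G → KContractible k G
  step : ∀ {n m k} {G : Graph n} {H : Graph m} {u v} →
         Contraction G H u v → KContractible k H → KContractible (suc k) G

sumFin : ∀ l → (Fin l → ℕ) → ℕ
sumFin zero f = 0
sumFin (suc l) f = f fzero + sumFin l (λ i → f (fsuc i))

{-# OPTIONS --safe #-}
-- The blocks of G form a block system: connected induced subgraphs ("pieces") that cover
-- every edge, pairwise share at most one vertex, and admit no walk that leaves a piece at p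
-- and re-enters it avoiding p (such a walk, shortened to a path, would be an ear enlarging
-- the block). A cycle through an edge of a piece stays inside it, so G is a cactus iff every
-- piece is. Contracting an edge uv of G amounts to contracting uv inside the unique piece
-- containing it, and the images of the pieces form a block system of the contracted graph.
-- Hence a contraction sequence for G distributes over the blocks, and conversely contraction
-- sequences for the blocks can be replayed one edge at a time in G.

module Submission where

open import Defs
open import Data.Nat using (ℕ; _≤_)
open import Data.Fin using (Fin)
open import Data.Product using (Σ; ∃; _×_)
open import Relation.Binary.PropositionalEquality using (_≡_)
open import Function.Bundles using (_⇔_)

open import Data.Bool using (Bool; true; false; if_then_else_; T)
import Data.Bool.Properties as Bool
open import Data.Empty using (⊥; ⊥-elim)
open import Data.Fin using (zero; suc; punchIn; punchOut; toℕ; inject₁; fromℕ)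
open import Data.Fin.Induction using (<-weakInduction; <-weakInduction-startingFrom)
open import Data.Fin.Properties
  using ( _≟_; any?; toℕ-injective; toℕ-inject₁; inject₁ℕ<; toℕ-fromℕ; toℕ-fromℕ<; ≤fromℕ
        ; punchInᵢ≢i; punchOut-punchIn; punchOut-cong; punchOut-injective)
open import Data.Nat using (zero; suc; z≤n; s≤s; _+_; _%_)
open import Data.Nat.DivMod using (m<n⇒m%n≡m; n%n≡0)
import Data.Nat.Properties as ℕ
open import Data.Product using (proj₁; proj₂; _,_; swap)
open import Data.Sum using (_⊎_; inj₁; inj₂; fromInj₂)
open import Data.Unit using (⊤; tt)
open import Data.Vec.Functional using (updateAt)
open import Data.Vec.Functional.Properties using (updateAt-updates; updateAt-minimal)
open import Function using (_∘_; case_of_)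
open import Function.Bundles using (mk⇔; module Equivalence)
open import Relation.Binary.PropositionalEquality using (refl; trans; cong; subst; subst₂; _≢_)
import Relation.Binary.PropositionalEquality as ≡
open import Relation.Nullary using (Dec; yes; no; ¬_)
open import Relation.Nullary.Decidable
  using ( _⊎-dec_; _×-dec_; ¬?; does; does-⇔; dec-true; dec-false; isYes; toWitness; fromWitness
        ; ¬¬-excluded-middle; decidable-stable)
open import Relation.Nullary.Negation using (¬¬-map; contradiction)

open Equivalence using (to; from)
open ≡.≡-Reasoning

Adj-sym : ∀ {n} (G : Graph n) {x y} → Adj G x y → Adj G y x
Adj-sym G {x} {y} xy = trans (sym G y x) xy

Adj⇒≢ : ∀ {n} (G : Graph n) {x y} → Adj G x y → x ≢ y
Adj⇒≢ G {x} xy refl = case trans (≡.sym xy) (irrefl G x) of λ ()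

module _ {n} {G : Graph n} where

  Reach-mono : ∀ {P Q : VSet n} → P ⊆ Q → ∀ {x y} → Reach G P x y → Reach G Q x y
  Reach-mono P⊆Q (here p) = here (P⊆Q _ p)
  Reach-mono P⊆Q (there p xz w) = there (P⊆Q _ p) xz (Reach-mono P⊆Q w)

  Reach-source : ∀ {P x y} → Reach G P x y → P x
  Reach-source (here p) = p
  Reach-source (there p _ _) = p

  Reach-target : ∀ {P x y} → Reach G P x y → P y
  Reach-target (here p) = p
  Reach-target (there _ _ w) = Reach-target w

  Reach-trans : ∀ {P x y z} → Reach G P x y → Reach G P y z → Reach G P x z
  Reach-trans (here _) w = w
  Reach-trans (there p xz w) w′ = there p xz (Reach-trans w w′)

  Reach-snoc : ∀ {P x y z} → Reach G P x y → Adj G y z → P z → Reach G P x z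
  Reach-snoc w yz pz = Reach-trans w (there (Reach-target w) yz (here pz))

  Reach-sym : ∀ {P x y} → Reach G P x y → Reach G P y x
  Reach-sym (here p) = here p
  Reach-sym (there p xz w) = Reach-snoc (Reach-sym w) (Adj-sym G xz) p

  Reach-avoid : ∀ {P x y} v → Reach G P x y → P v ⊎ Reach G (λ z → P z × z ≢ v) x y
  Reach-avoid v (here {x} p) with x ≟ v
  ... | yes refl = inj₁ p
  ... | no x≢v = inj₂ (here (p , x≢v))
  Reach-avoid v (there {x} p xz w) with x ≟ v | Reach-avoid v w
  ... | yes refl | _ = inj₁ p
  ... | no _ | inj₁ pv = inj₁ pv
  ... | no x≢v | inj₂ w′ = inj₂ (there (p , x≢v) xz w′)

  _∈ʷ_ : ∀ {P x y} → Fin n → Reach G P x y → Set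
  z ∈ʷ here {x} _ = z ≡ x
  z ∈ʷ there {x} _ _ w = z ≡ x ⊎ z ∈ʷ w

  _∈ʷ?_ : ∀ {P x y} z (w : Reach G P x y) → Dec (z ∈ʷ w)
  z ∈ʷ? here {x} _ = z ≟ x
  z ∈ʷ? there {x} _ _ w = (z ≟ x) ⊎-dec (z ∈ʷ? w)

  IsPath : ∀ {P x y} → Reach G P x y → Set
  IsPath (here _) = ⊤
  IsPath (there {x} _ _ w) = ¬ x ∈ʷ w × IsPath w

  source-∈ʷ : ∀ {P x y} (w : Reach G P x y) → x ∈ʷ w
  source-∈ʷ (here _) = refl
  source-∈ʷ (there _ _ _) = inj₁ refl

  ∈ʷ⇒P : ∀ {P x y} (w : Reach G P x y) {z} → z ∈ʷ w → P z
  ∈ʷ⇒P (here p) refl = p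
  ∈ʷ⇒P (there p _ _) (inj₁ refl) = p
  ∈ʷ⇒P (there _ _ w) (inj₂ z∈w) = ∈ʷ⇒P w z∈w

  Reach-∈ʷ : ∀ {P x y} (w : Reach G P x y) → Reach G (_∈ʷ w) x y
  Reach-∈ʷ (here p) = here refl
  Reach-∈ʷ (there p xz w) = there (inj₁ refl) xz (Reach-mono (λ _ → inj₂) (Reach-∈ʷ w))

  suffix : ∀ {P x y} (w : Reach G P x y) {z} → z ∈ʷ w →
           Σ (Reach G P z y) λ w′ → (_∈ʷ w′) ⊆ (_∈ʷ w) × (IsPath w → IsPath w′)
  suffix (here p) refl = here p , (λ _ t∈w → t∈w) , (λ w-path → w-path)
  suffix (there p xz w) (inj₁ refl) = there p xz w , (λ _ t∈w → t∈w) , (λ w-path → w-path)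
  suffix (there p xz w) (inj₂ z∈w) with suffix w z∈w
  ... | w′ , w′⊆w , path = w′ , (λ t t∈w′ → inj₂ (w′⊆w t t∈w′)) , (λ w-path → path (proj₂ w-path))

  Reach-suffix : ∀ {P x y} (w : Reach G P x y) {z} → z ∈ʷ w → Reach G (_∈ʷ w) z y
  Reach-suffix w z∈w with suffix w z∈w
  ... | w′ , w′⊆w , _ = Reach-mono w′⊆w (Reach-∈ʷ w′)

  toPath : ∀ {P x y} → Reach G P x y → Σ (Reach G P x y) IsPath
  toPath (here p) = here p , tt
  toPath (there {x} p xz w) with toPath w
  ... | w′ , w′-path with x ∈ʷ? w′
  ...   | no x∉w′ = there p xz w′ , x∉w′ , w′-path
  ...   | yes x∈w′ with suffix w′ x∈w′
  ...     | w″ , _ , w″-path = w″ , w″-path w′-path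

  path-split : ∀ {P a b} (w : Reach G P a b) → IsPath w → ∀ {z} v → z ∈ʷ w → z ≢ v →
               Reach G (λ t → t ∈ʷ w × t ≢ v) z a ⊎ Reach G (λ t → t ∈ʷ w × t ≢ v) z b
  path-split (here _) _ v refl z≢v = inj₁ (here (refl , z≢v))
  path-split (there _ _ _) _ v (inj₁ refl) z≢v = inj₁ (here (inj₁ refl , z≢v))
  path-split {a = a} (there _ ab w) (a∉w , w-path) v (inj₂ z∈w) z≢v
    with path-split w w-path v z∈w z≢v
  ... | inj₂ z⇝b = inj₂ (Reach-mono (λ _ (t∈w , t≢v) → inj₂ t∈w , t≢v) z⇝b)
  ... | inj₁ z⇝a′ with a ≟ v
  ...   | no a≢v = inj₁ (Reach-snoc (Reach-mono (λ _ (t∈w , t≢v) → inj₂ t∈w , t≢v) z⇝a′)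
                                    (Adj-sym G ab) (inj₁ refl , a≢v))
  ...   | yes refl = inj₂ (Reach-mono (λ t t∈w → inj₂ t∈w , λ { refl → a∉w t∈w }) (Reach-suffix w z∈w))

NoReentry : ∀ {n} → Graph n → VSet n → Set
NoReentry G S = ∀ {p q r} → S p → ¬ S q → Adj G p q → Reach G (λ z → z ≢ p) q r → ¬ S r

NoReentry-resp-≐ : ∀ {n} {G : Graph n} {S T : VSet n} → S ≐ T → NoReentry G S → NoReentry G T
NoReentry-resp-≐ (S⊆T , T⊆S) noReentry tp ¬tq pq w tr =
  noReentry (T⊆S _ tp) (¬tq ∘ S⊆T _) pq w (T⊆S _ tr)

module _ {n} {G : Graph n} where

  nonseparable-resp-≐ : ∀ {S T : VSet n} → S ≐ T → NonseparableOn G S → NonseparableOn G T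
  nonseparable-resp-≐ (S⊆T , T⊆S) (((x , sx) , conn) , cut) =
    ((x , S⊆T x sx) , λ a b ta tb → Reach-mono S⊆T (conn a b (T⊆S a ta) (T⊆S b tb))) ,
    λ v a b tv ta tb a≢v b≢v →
      Reach-mono (λ z (sz , z≢v) → S⊆T z sz , z≢v) (cut v a b (T⊆S v tv) (T⊆S a ta) (T⊆S b tb) a≢v b≢v)

  nonseparable-avoid : ∀ {S : VSet n} → NonseparableOn G S → ∀ {v x y} → S x → S y → x ≢ v → y ≢ v →
                       Reach G (λ z → S z × z ≢ v) x y
  nonseparable-avoid ((_ , conn) , cut) {v} sx sy x≢v y≢v with Reach-avoid v (conn _ _ sx sy)
  ... | inj₁ sv = cut v _ _ sv sx sy x≢v y≢v
  ... | inj₂ w = w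

  nonseparable-⋃ : ∀ {I : Set} {S : I → VSet n} {x y} → I → x ≢ y →
                   (∀ i → NonseparableOn G (S i)) → (∀ i → S i x) → (∀ i → S i y) →
                   NonseparableOn G (λ z → ∃ λ i → S i z)
  nonseparable-⋃ {S = S} {x} {y} i₀ x≢y ns sx sy = ((x , i₀ , sx i₀) , conn) , cut
    where
    U : VSet n
    U z = ∃ λ i → S i z

    conn : ∀ a b → U a → U b → Reach G U a b
    conn a b (i , sa) (j , sb) =
      Reach-trans (Reach-mono (λ _ → i ,_) (proj₂ (proj₁ (ns i)) a x sa (sx i)))
                  (Reach-mono (λ _ → j ,_) (proj₂ (proj₁ (ns j)) x b (sx j) sb))

    -- x ≠ y, so every v misses one of them, which lies in every S i
    hub : ∀ v → ∃ λ h → (∀ i → S i h) × h ≢ v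
    hub v with x ≟ v
    ... | yes refl = y , sy , x≢y ∘ ≡.sym
    ... | no x≢v = x , sx , x≢v

    cut : ∀ v a b → U v → U a → U b → a ≢ v → b ≢ v → Reach G (λ z → U z × z ≢ v) a b
    cut v a b _ ua ub a≢v b≢v = Reach-trans (toHub ua a≢v) (Reach-sym (toHub ub b≢v))
      where
      toHub : ∀ {z} → U z → z ≢ v → Reach G (λ t → U t × t ≢ v) z (proj₁ (hub v))
      toHub (i , sz) z≢v = Reach-mono (λ _ (st , t≢v) → (i , st) , t≢v)
        (nonseparable-avoid (ns i) sz (proj₁ (proj₂ (hub v)) i) z≢v (proj₂ (proj₂ (hub v))))

  blocks-share-≤1 : ∀ {S T : VSet n} {x y} → IsBlock G S → IsBlock G T →
                    S x → T x → S y → T y → x ≢ y → S ≐ T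
  blocks-share-≤1 {S} {T} (nsS , maxS) (nsT , maxT) sx tx sy ty x≢y =
    (λ z sz → maxT U (λ _ → false ,_) nsU z (true , sz)) ,
    (λ z tz → maxS U (λ _ → true ,_) nsU z (false , tz))
    where
    S∨T : Bool → VSet n
    S∨T b = if b then S else T
    U : VSet n
    U z = ∃ λ b → S∨T b z
    nsU : NonseparableOn G U
    nsU = nonseparable-⋃ true x≢y (λ { true → nsS ; false → nsT })
                                  (λ { true → sx ; false → tx }) (λ { true → sy ; false → ty })

  nonseparable-∪-path : ∀ {S : VSet n} {p q r} → NonseparableOn G S → S p → Adj G p q →
                        (w : Reach G (λ z → z ≢ p) q r) → IsPath w → S r →
                        NonseparableOn G (λ z → S z ⊎ z ∈ʷ w)
  nonseparable-∪-path {S} {p} {q} {r} nsS sp pq w w-path sr =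
    ((p , inj₁ sp) , λ a b ua ub → Reach-trans (toR ua) (Reach-sym (toR ub))) ,
    λ v a b _ ua ub a≢v b≢v → cut v (toS v ua a≢v) (toS v ub b≢v)
    where
    S′ : VSet n
    S′ z = S z ⊎ z ∈ʷ w

    toR : ∀ {z} → S′ z → Reach G S′ z r
    toR (inj₁ sz) = Reach-mono (λ _ → inj₁) (proj₂ (proj₁ nsS) _ r sz sr)
    toR (inj₂ z∈w) = Reach-mono (λ _ → inj₂) (Reach-suffix w z∈w)

    ToS : Fin n → Fin n → Set
    ToS v z = ∃ λ h → S h × h ≢ v × Reach G (λ t → S′ t × t ≢ v) z h

    along-w : ∀ {v z h} → Reach G (λ t → t ∈ʷ w × t ≢ v) z h → Reach G (λ t → S′ t × t ≢ v) z h
    along-w = Reach-mono (λ _ (t∈w , t≢v) → inj₂ t∈w , t≢v)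

    -- a vertex of w escapes v along w, towards r or (through q) towards p
    toS : ∀ v {z} → S′ z → z ≢ v → ToS v z
    toS v {z} (inj₁ sz) z≢v = z , sz , z≢v , here (inj₁ sz , z≢v)
    toS v (inj₂ z∈w) z≢v with p ≟ v
    ... | yes refl = r , sr , Reach-target w ,
                     Reach-mono (λ t t∈w → inj₂ t∈w , ∈ʷ⇒P w t∈w) (Reach-suffix w z∈w)
    ... | no p≢v with path-split w w-path v z∈w z≢v
    ...   | inj₁ z⇝q = p , sp , p≢v , Reach-snoc (along-w z⇝q) (Adj-sym G pq) (inj₁ sp , p≢v)
    ...   | inj₂ z⇝r = r , sr , proj₂ (Reach-target z⇝r) , along-w z⇝r

    cut : ∀ v {a b} → ToS v a → ToS v b → Reach G (λ t → S′ t × t ≢ v) a b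
    cut v (h₁ , sh₁ , h₁≢v , a⇝h₁) (h₂ , sh₂ , h₂≢v , b⇝h₂) =
      Reach-trans a⇝h₁ (Reach-trans (Reach-mono (λ _ (st , t≢v) → inj₁ st , t≢v)
                                                (nonseparable-avoid nsS sh₁ sh₂ h₁≢v h₂≢v))
                                    (Reach-sym b⇝h₂))

  block-noReentry : ∀ {S : VSet n} → IsBlock G S → NoReentry G S
  block-noReentry (nsS , maxS) sp q∉S pq w sr with toPath w
  ... | w′ , w′-path =
    q∉S (maxS _ (λ _ → inj₁) (nonseparable-∪-path nsS sp pq w′ w′-path sr) _ (inj₂ (source-∈ʷ w′)))

  edge-nonseparable : ∀ {x y} → Adj G x y → NonseparableOn G (λ z → z ≡ x ⊎ z ≡ y)
  edge-nonseparable {x} {y} xy = ((x , inj₁ refl) , conn) , cut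
    where
    E : VSet n
    E z = z ≡ x ⊎ z ≡ y

    conn : ∀ a b → E a → E b → Reach G E a b
    conn _ _ (inj₁ refl) (inj₁ refl) = here (inj₁ refl)
    conn _ _ (inj₁ refl) (inj₂ refl) = there (inj₁ refl) xy (here (inj₂ refl))
    conn _ _ (inj₂ refl) (inj₁ refl) = there (inj₂ refl) (Adj-sym G xy) (here (inj₁ refl))
    conn _ _ (inj₂ refl) (inj₂ refl) = here (inj₂ refl)

    cut : ∀ v a b → E v → E a → E b → a ≢ v → b ≢ v → Reach G (λ z → E z × z ≢ v) a b
    cut _ _ _ _ (inj₁ refl) (inj₁ refl) a≢v _ = here (inj₁ refl , a≢v)
    cut _ _ _ _ (inj₂ refl) (inj₂ refl) a≢v _ = here (inj₂ refl , a≢v)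
    cut _ _ _ (inj₁ refl) (inj₁ refl) (inj₂ refl) a≢v _ = ⊥-elim (a≢v refl)
    cut _ _ _ (inj₂ refl) (inj₁ refl) (inj₂ refl) _ b≢v = ⊥-elim (b≢v refl)
    cut _ _ _ (inj₁ refl) (inj₂ refl) (inj₁ refl) _ b≢v = ⊥-elim (b≢v refl)
    cut _ _ _ (inj₂ refl) (inj₂ refl) (inj₁ refl) a≢v _ = ⊥-elim (a≢v refl)

¬¬-decidable : ∀ {n} (P : Fin n → Set) → ¬ ¬ (∀ z → Dec (P z))
¬¬-decidable {zero} P = contradiction λ ()
¬¬-decidable {suc n} P k =
  ¬¬-excluded-middle λ P0? → ¬¬-decidable (P ∘ suc) λ P+? → k λ { zero → P0? ; (suc z) → P+? z }

≐-isYes : ∀ {n} {S : VSet n} (S? : ∀ z → Dec (S z)) → S ≐ (λ z → T (isYes (S? z)))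
≐-isYes S? = (λ _ → fromWitness) , (λ _ → toWitness)

module EdgeHull {n} {G : Graph n} {x y} (xy : Adj G x y) where

  -- Bool-valued, so that the union Hull below is again a VSet and not in Set₁
  Through : Set
  Through = Σ (Fin n → Bool) λ B → NonseparableOn G (T ∘ B) × T (B x) × T (B y)

  Hull : VSet n
  Hull z = ∃ λ (B : Through) → T (proj₁ B z)

  edge-through : Through
  edge-through = isYes ∘ E? , nonseparable-resp-≐ (≐-isYes E?) (edge-nonseparable xy) ,
                 fromWitness (inj₁ refl) , fromWitness (inj₂ refl)
    where
    E? : ∀ z → Dec (z ≡ x ⊎ z ≡ y)
    E? z = (z ≟ x) ⊎-dec (z ≟ y)

  Hull-x : Hull x
  Hull-x = edge-through , proj₁ (proj₂ (proj₂ edge-through))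

  Hull-y : Hull y
  Hull-y = edge-through , proj₂ (proj₂ (proj₂ edge-through))

  Hull-block : (∀ z → Dec (Hull z)) → IsBlock G Hull
  Hull-block Hull? = nonseparable , maximal
    where
    nonseparable : NonseparableOn G Hull
    nonseparable = nonseparable-⋃ edge-through (Adj⇒≢ G xy)
      (proj₁ ∘ proj₂) (proj₁ ∘ proj₂ ∘ proj₂) (proj₂ ∘ proj₂ ∘ proj₂)

    -- Hull z is decidable, so it suffices to prove it assuming S decidable
    maximal : ∀ S → Hull ⊆ S → NonseparableOn G S → S ⊆ Hull
    maximal S Hull⊆S nsS z sz = decidable-stable (Hull? z) (¬¬-map through-S (¬¬-decidable S))
      where
      through-S : (∀ t → Dec (S t)) → Hull z
      through-S S? = (isYes ∘ S? , nonseparable-resp-≐ (≐-isYes S?) nsS ,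
                      fromWitness (Hull⊆S x Hull-x) , fromWitness (Hull⊆S y Hull-y)) ,
                     fromWitness sz

does⇒ : ∀ {A : Set} (a? : Dec A) → does a? ≡ true → A
does⇒ (yes a) _ = a

module EdgeContraction {n} (G : Graph (suc n)) {u v} (uv : Adj G u v) where

  v≢u : v ≢ u
  v≢u = Adj⇒≢ G uv ∘ ≡.sym

  -- send v to u, then close the gap left by v
  merge : Fin (suc n) → Fin n
  merge x with v ≟ x
  ... | yes _ = punchOut v≢u
  ... | no v≢x = punchOut v≢x

  merge-punchIn : ∀ a → merge (punchIn v a) ≡ a
  merge-punchIn a with v ≟ punchIn v a
  ... | yes v≡a′ = ⊥-elim (punchInᵢ≢i v a (≡.sym v≡a′))
  ... | no _ = punchOut-punchIn v

  merge-u≡merge-v : merge u ≡ merge v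
  merge-u≡merge-v with v ≟ u | v ≟ v
  ... | yes v≡u | _ = ⊥-elim (v≢u v≡u)
  ... | no _ | yes _ = punchOut-cong v refl
  ... | no _ | no v≢v = ⊥-elim (v≢v refl)

  merge-injective : ∀ x y → merge x ≡ merge y → x ≡ y ⊎ ((x ≡ u ⊎ x ≡ v) × (y ≡ u ⊎ y ≡ v))
  merge-injective x y eq with v ≟ x | v ≟ y
  ... | yes refl | yes refl = inj₁ refl
  ... | yes refl | no v≢y = inj₂ (inj₂ refl , inj₁ (≡.sym (punchOut-injective v≢u v≢y eq)))
  ... | no v≢x | yes refl = inj₂ (inj₁ (punchOut-injective v≢x v≢u eq) , inj₂ refl)
  ... | no v≢x | no v≢y = inj₁ (punchOut-injective v≢x v≢y eq)

  Edge : Fin n → Fin n → Set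
  Edge a b = a ≢ b × (∃ λ x → ∃ λ y → merge x ≡ a × merge y ≡ b × Adj G x y)

  Edge? : ∀ a b → Dec (Edge a b)
  Edge? a b = ¬? (a ≟ b) ×-dec
    any? λ x → any? λ y → (merge x ≟ a) ×-dec (merge y ≟ b) ×-dec (adj G x y Bool.≟ true)

  Edge-sym : ∀ {a b} → Edge a b → Edge b a
  Edge-sym (a≢b , x , y , mx , my , xy) = a≢b ∘ ≡.sym , y , x , my , mx , Adj-sym G xy

  contracted : Graph n
  contracted = record
    { adj    = λ a b → does (Edge? a b)
    ; sym    = λ a b → does-⇔ (mk⇔ Edge-sym Edge-sym) (Edge? a b) (Edge? b a)
    ; irrefl = λ a → dec-false (Edge? a a) (λ (a≢a , _) → a≢a refl)
    }

  contraction : Contraction G contracted u v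
  contraction = uv , merge , (λ a → punchIn v a , merge-punchIn a) , merge-u≡merge-v , merge-injective ,
    λ a b → does⇒ (Edge? a b) , dec-true (Edge? a b)

contract-edge : ∀ {n} (G : Graph n) {u v} → Adj G u v → ∃ λ m → Σ (Graph m) λ H → Contraction G H u v
contract-edge {suc n} G uv = n , EdgeContraction.contracted G uv , EdgeContraction.contraction G uv

module ContractionProperties {n n′} {G : Graph n} {G′ : Graph n′} {u v} (con : Contraction G G′ u v) where

  u~v : Adj G u v
  u~v = proj₁ con

  π : Fin n → Fin n′
  π = proj₁ (proj₂ con)

  π-surjective : ∀ a → ∃ λ x → π x ≡ a
  π-surjective = proj₁ (proj₂ (proj₂ con))

  π-u≡π-v : π u ≡ π v
  π-u≡π-v = proj₁ (proj₂ (proj₂ (proj₂ con)))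

  π-fibres : ∀ x y → π x ≡ π y → x ≡ y ⊎ ((x ≡ u ⊎ x ≡ v) × (y ≡ u ⊎ y ≡ v))
  π-fibres = proj₁ (proj₂ (proj₂ (proj₂ (proj₂ con))))

  Adj′⇒ : ∀ {a b} → Adj G′ a b → a ≢ b × (∃ λ x → ∃ λ y → π x ≡ a × π y ≡ b × Adj G x y)
  Adj′⇒ = proj₁ (proj₂ (proj₂ (proj₂ (proj₂ (proj₂ con)))) _ _)

  ⇒Adj′ : ∀ {a b} → a ≢ b × (∃ λ x → ∃ λ y → π x ≡ a × π y ≡ b × Adj G x y) → Adj G′ a b
  ⇒Adj′ = proj₂ (proj₂ (proj₂ (proj₂ (proj₂ (proj₂ con)))) _ _)

  Merged : Fin n → Fin n → Set
  Merged x y = (x ≡ u × y ≡ v) ⊎ (x ≡ v × y ≡ u)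

  π-≡ : ∀ {x y} → π x ≡ π y → x ≡ y ⊎ Merged x y
  π-≡ {x} {y} eq with π-fibres x y eq
  ... | inj₁ x≡y = inj₁ x≡y
  ... | inj₂ (inj₁ refl , inj₁ refl) = inj₁ refl
  ... | inj₂ (inj₁ x≡u , inj₂ y≡v) = inj₂ (inj₁ (x≡u , y≡v))
  ... | inj₂ (inj₂ x≡v , inj₁ y≡u) = inj₂ (inj₂ (x≡v , y≡u))
  ... | inj₂ (inj₂ refl , inj₂ refl) = inj₁ refl

  Merged-sym : ∀ {x y} → Merged x y → Merged y x
  Merged-sym (inj₁ (x≡u , y≡v)) = inj₂ (y≡v , x≡u)
  Merged-sym (inj₂ (x≡v , y≡u)) = inj₁ (y≡u , x≡v)

  Merged⇒Adj : ∀ {x y} → Merged x y → Adj G x y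
  Merged⇒Adj (inj₁ (refl , refl)) = u~v
  Merged⇒Adj (inj₂ (refl , refl)) = Adj-sym G u~v

  Merged⇒≢ : ∀ {x y} → Merged x y → x ≢ y
  Merged⇒≢ = Adj⇒≢ G ∘ Merged⇒Adj

  π-merged : ∀ {x y} → Merged x y → π x ≡ π u
  π-merged (inj₁ (refl , refl)) = refl
  π-merged (inj₂ (refl , refl)) = ≡.sym π-u≡π-v

  π-Merged : ∀ {x y} → Merged x y → π x ≡ π y
  π-Merged m = trans (π-merged m) (≡.sym (π-merged (Merged-sym m)))

  Adj-π : ∀ {x y} → Adj G x y → π x ≢ π y → Adj G′ (π x) (π y)
  Adj-π {x} {y} xy πx≢πy = ⇒Adj′ (πx≢πy , x , y , refl , refl , xy)

  Reach-π : ∀ {Q x y} → Reach G Q x y → Reach G′ (λ _ → ⊤) (π x) (π y)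
  Reach-π (here _) = here tt
  Reach-π {Q} (there {x} {z} {y} _ xz w) with π x ≟ π z
  ... | yes πx≡πz = subst (λ a → Reach G′ (λ _ → ⊤) a (π y)) (≡.sym πx≡πz) (Reach-π {Q} w)
  ... | no πx≢πz = there tt (Adj-π xz πx≢πz) (Reach-π {Q} w)

  connected : Connected G → Connected G′
  connected ((x , _) , conn) = (π x , tt) , λ a b _ _ → reach (π-surjective a) (π-surjective b)
    where
    reach : ∀ {a b} → (∃ λ x → π x ≡ a) → (∃ λ y → π y ≡ b) → Reach G′ (λ _ → ⊤) a b
    reach (x , refl) (y , refl) = Reach-π {λ _ → ⊤} (conn x y tt tt)

  Reach-lift : ∀ {Q a b} → Reach G′ Q a b → ∀ {x y} → π x ≡ a → π y ≡ b → Reach G (Q ∘ π) x y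
  Reach-lift {Q} (here q) refl πy≡πx = fibre (≡.sym πy≡πx) q
    where
    fibre : ∀ {x y} → π x ≡ π y → Q (π x) → Reach G (Q ∘ π) x y
    fibre eq q with π-≡ eq
    ... | inj₁ refl = here q
    ... | inj₂ m = there q (Merged⇒Adj m) (here (subst Q eq q))
  Reach-lift {Q} (there q ab w) refl πy≡b with Adj′⇒ ab
  ... | _ , x′ , y′ , πx′≡a , πy′≡z , x′y′ =
    Reach-trans (Reach-lift {Q} (here q) refl πx′≡a)
                (there (subst Q (≡.sym πx′≡a) q) x′y′ (Reach-lift w πy′≡z πy≡b))

next-inject₁ : ∀ {r} (i : Fin r) → next (inject₁ i) ≡ suc i
next-inject₁ {r} i = toℕ-injective (begin
  toℕ (next (inject₁ i))        ≡⟨ toℕ-fromℕ< _ ⟩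
  suc (toℕ (inject₁ i)) % suc r ≡⟨ m<n⇒m%n≡m (s≤s (inject₁ℕ< i)) ⟩
  suc (toℕ (inject₁ i))         ≡⟨ cong suc (toℕ-inject₁ i) ⟩
  toℕ (suc i)                   ∎)

next-fromℕ : ∀ r → next (fromℕ r) ≡ zero
next-fromℕ r = toℕ-injective (begin
  toℕ (next (fromℕ r))        ≡⟨ toℕ-fromℕ< _ ⟩
  suc (toℕ (fromℕ r)) % suc r ≡⟨ cong (λ t → suc t % suc r) (toℕ-fromℕ r) ⟩
  suc r % suc r               ≡⟨ n%n≡0 (suc r) ⟩
  0                           ∎)

next-induction : ∀ {r} (P : Fin (suc r) → Set) {j} → P j → (∀ i → P i → P (next i)) → ∀ i → P i
next-induction {r} P {j} Pj P⇒P∘next = <-weakInduction P P-zero P⇒P∘suc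
  where
  P⇒P∘suc : ∀ i → P (inject₁ i) → P (suc i)
  P⇒P∘suc i = subst P (next-inject₁ i) ∘ P⇒P∘next (inject₁ i)
  P-last : P (fromℕ r)
  P-last = <-weakInduction-startingFrom P Pj P⇒P∘suc (≤fromℕ j)
  P-zero : P zero
  P-zero = subst P (next-fromℕ r) (P⇒P∘next (fromℕ r) P-last)

next-induction-avoiding : ∀ {r} (Q : Fin (suc r) → Set) {i} → Q (next i) →
                          (∀ k → Q k → next k ≢ i → Q (next k)) → ∀ k → k ≢ i → Q k
next-induction-avoiding Q {i} Q-next-i Q⇒Q∘next k k≢i =
  fromInj₂ (⊥-elim ∘ k≢i) (next-induction P (inj₂ Q-next-i) P⇒P∘next k)
  where
  P : Fin _ → Set
  P k = k ≡ i ⊎ Q k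
  P⇒P∘next : ∀ k → P k → P (next k)
  P⇒P∘next k (inj₁ refl) = inj₂ Q-next-i
  P⇒P∘next k (inj₂ Qk) with next k ≟ i
  ... | yes next-k≡i = inj₁ next-k≡i
  ... | no next-k≢i = inj₂ (Q⇒Q∘next k Qk next-k≢i)

module _ {n} {G : Graph n} (C : Cycle G) where
  open Cycle C

  cycle-arc : ∀ i k → k ≢ i → Reach G (λ z → z ≢ c i) (c (next i)) (c k)
  cycle-arc i = next-induction-avoiding (λ k → Reach G (λ z → z ≢ c i) (c (next i)) (c k))
    (here (Adj⇒≢ G (edges i) ∘ ≡.sym))
    (λ k arc next-k≢i → Reach-snoc arc (edges k) (next-k≢i ∘ inj _ _))

  cycle-⊆ : ∀ {S : VSet n} → (∀ x → Dec (S x)) → NoReentry G S →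
            ∀ {j} → S (c j) → S (c (next j)) → ∀ k → S (c k)
  cycle-⊆ {S} S? noReentry {j} sj snj = next-induction (S ∘ c) sj S⇒S∘next
    where
    S⇒S∘next : ∀ i → S (c i) → S (c (next i))
    S⇒S∘next i si with S? (c (next i)) | j ≟ i
    ... | yes sni | _ = sni
    ... | no sni | yes refl = ⊥-elim (sni snj)
    ... | no sni | no j≢i = ⊥-elim (noReentry si sni (edges i) (cycle-arc i j j≢i) sj)

  OnCycle-⊆ : ∀ {S : VSet n} → (∀ x → Dec (S x)) → NoReentry G S →
              ∀ {a b} → OnCycle C a b → S a → S b → ∀ k → S (c k)
  OnCycle-⊆ S? noReentry (j , inj₁ (refl , refl)) sa sb = cycle-⊆ S? noReentry sa sb
  OnCycle-⊆ S? noReentry (j , inj₂ (refl , refl)) sa sb = cycle-⊆ S? noReentry sb sa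

EdgeOf : ∀ {n r} → (Fin (suc r) → Fin n) → Fin n → Fin n → Set
EdgeOf c a b = ∃ λ i → (c i ≡ a × c (next i) ≡ b) ⊎ (c i ≡ b × c (next i) ≡ a)

EdgeOf-⊆ : ∀ {n r} {c : Fin (suc r) → Fin n} {S : VSet n} → (∀ k → S (c k)) →
           ∀ {a b} → EdgeOf c a b → S a × S b
EdgeOf-⊆ sc (i , inj₁ (refl , refl)) = sc i , sc (next i)
EdgeOf-⊆ sc (i , inj₂ (refl , refl)) = sc (next i) , sc i

EdgeOf-map : ∀ {m n r} {c : Fin (suc r) → Fin m} {d : Fin (suc r) → Fin n} {e : Fin m → Fin n} →
             (∀ a b → e a ≡ e b → a ≡ b) → (∀ k → e (c k) ≡ d k) →
             ∀ {a b} → EdgeOf c a b ⇔ EdgeOf d (e a) (e b)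
EdgeOf-map {c = c} {d} {e} e-inj ec≡d = mk⇔ forth back
  where
  forth : ∀ {a b} → EdgeOf c a b → EdgeOf d (e a) (e b)
  forth (i , inj₁ (refl , refl)) = i , inj₁ (≡.sym (ec≡d i) , ≡.sym (ec≡d (next i)))
  forth (i , inj₂ (refl , refl)) = i , inj₂ (≡.sym (ec≡d i) , ≡.sym (ec≡d (next i)))
  cancel : ∀ {k a} → d k ≡ e a → c k ≡ a
  cancel {k} dk≡ea = e-inj _ _ (trans (ec≡d k) dk≡ea)
  back : ∀ {a b} → EdgeOf d (e a) (e b) → EdgeOf c a b
  back (i , inj₁ (di≡ea , dni≡eb)) = i , inj₁ (cancel di≡ea , cancel dni≡eb)
  back (i , inj₂ (di≡eb , dni≡ea)) = i , inj₂ (cancel di≡eb , cancel dni≡ea)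

module InducedSubgraph {m n} {B : Graph m} {G : Graph n} {e : Fin m → Fin n}
  (e-injective : ∀ a b → e a ≡ e b → a ≡ b)
  (induced : ∀ a b → adj B a b ≡ adj G (e a) (e b)) where

  Adj-e : ∀ {a b} → Adj B a b → Adj G (e a) (e b)
  Adj-e {a} {b} = trans (≡.sym (induced a b))

  Adj-e⁻¹ : ∀ {a b} → Adj G (e a) (e b) → Adj B a b
  Adj-e⁻¹ {a} {b} = trans (induced a b)

  Reach-e : ∀ {Q a b} → Reach B Q a b → Reach G (Image e) (e a) (e b)
  Reach-e (here _) = here (_ , refl)
  Reach-e (there _ ab w) = there (_ , refl) (Adj-e ab) (Reach-e w)

  Reach-e⁻¹ : ∀ {x y} → Reach G (Image e) x y → ∀ {a b} → e a ≡ x → e b ≡ y → Reach B (λ _ → ⊤) a b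
  Reach-e⁻¹ (here _) ea≡x eb≡x = subst (Reach B _ _) (e-injective _ _ (trans ea≡x (≡.sym eb≡x))) (here tt)
  Reach-e⁻¹ (there _ xz w) refl eb≡y with Reach-source w
  ... | c , refl = there tt (Adj-e⁻¹ xz) (Reach-e⁻¹ w refl eb≡y)

  connected⁻¹ : ConnectedOn G (Image e) → Connected B
  connected⁻¹ ((_ , a , _) , conn) =
    (a , tt) , λ c d _ _ → Reach-e⁻¹ (conn (e c) (e d) (c , refl) (d , refl)) refl refl

  cycle-e : Cycle B → Cycle G
  cycle-e C = record
    { r = r ; long = long ; c = e ∘ c
    ; inj = λ i j → inj i j ∘ e-injective _ _
    ; edges = Adj-e ∘ edges
    }
    where open Cycle C

  cycle-e⁻¹ : (C : Cycle G) → (∀ k → Image e (Cycle.c C k)) → Cycle B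
  cycle-e⁻¹ C in-e = record
    { r = r ; long = long ; c = proj₁ ∘ in-e
    ; inj = λ i j → inj i j ∘ λ eq → trans (≡.sym (proj₂ (in-e i))) (trans (cong e eq) (proj₂ (in-e j)))
    ; edges = λ i → Adj-e⁻¹ (subst₂ (Adj G) (≡.sym (proj₂ (in-e i))) (≡.sym (proj₂ (in-e (next i))))
                                         (edges i))
    }
    where open Cycle C

  OnCycle-e : ∀ C {a b} → OnCycle C a b ⇔ OnCycle (cycle-e C) (e a) (e b)
  OnCycle-e C = EdgeOf-map e-injective (λ _ → refl)

  OnCycle-e⁻¹ : ∀ C in-e {a b} → OnCycle (cycle-e⁻¹ C in-e) a b ⇔ OnCycle C (e a) (e b)
  OnCycle-e⁻¹ C in-e = EdgeOf-map e-injective (proj₂ ∘ in-e)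

  cactus⁻¹ : Connected B → Cactus G → Cactus B
  cactus⁻¹ connB (_ , unique) = connB , λ C D a b ab onC onD x y →
    let C⇔D = unique (cycle-e C) (cycle-e D) (e a) (e b) (Adj-e ab)
                     (to (OnCycle-e C) onC) (to (OnCycle-e D) onD) (e x) (e y)
    in from (OnCycle-e D) ∘ proj₁ C⇔D ∘ to (OnCycle-e C) ,
       from (OnCycle-e C) ∘ proj₂ C⇔D ∘ to (OnCycle-e D)

record Piece (n : ℕ) : Set where
  constructor piece
  field
    order : ℕ
    graph : Graph order
    embed : Fin order → Fin n
open Piece

Vertices : ∀ {n} → Piece n → VSet n
Vertices p = Image (embed p)

Vertices? : ∀ {n} (p : Piece n) x → Dec (Vertices p x)
Vertices? p x = any? λ a → embed p a ≟ x

record BlockSystem {n} (G : Graph n) {l} (P : Fin l → Piece n) : Set where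
  field
    embed-injective : ∀ i a b → embed (P i) a ≡ embed (P i) b → a ≡ b
    induced         : ∀ i a b → adj (graph (P i)) a b ≡ adj G (embed (P i) a) (embed (P i) b)
    connected       : ∀ i → Connected (graph (P i))
    covers          : ∀ {x y} → Adj G x y → ∃ λ i → Vertices (P i) x × Vertices (P i) y
    sharing-two⇒≡   : ∀ {i j x y} → Vertices (P i) x → Vertices (P j) x →
                      Vertices (P i) y → Vertices (P j) y → x ≢ y → i ≡ j
    noReentry       : ∀ i → NoReentry G (Vertices (P i))

module BlockSystemProperties {n} {G : Graph n} {l} {P : Fin l → Piece n} (sys : BlockSystem G P) where
  open BlockSystem sys

  module Sub i = InducedSubgraph {B = graph (P i)} {G = G} (embed-injective i) (induced i)

  Reach-piece : ∀ i {x y} → Vertices (P i) x → Vertices (P i) y → Reach G (Vertices (P i)) x y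
  Reach-piece i (a , refl) (b , refl) = Sub.Reach-e i (proj₂ (connected i) a b tt tt)

  -- otherwise a path from t to z inside piece k would re-enter piece j avoiding s
  edge-into-overlap⇒≡ : ∀ {j k s t z} → Adj G s t → Vertices (P j) s → Vertices (P k) t →
                        Vertices (P j) z → Vertices (P k) z → z ≢ s → z ≢ t → j ≡ k
  edge-into-overlap⇒≡ {j} {k} {s} {t} st sj tk zj zk z≢s z≢t with Vertices? (P j) t | Vertices? (P k) s
  ... | yes tj | _ = sharing-two⇒≡ zj zk tj tk z≢t
  ... | no _ | yes sk = sharing-two⇒≡ zj zk sj sk z≢s
  ... | no t∉j | no s∉k = ⊥-elim (noReentry j sj t∉j st
    (Reach-mono (λ w wk → s∉k ∘ λ w≡s → subst (Vertices (P k)) w≡s wk) (Reach-piece k tk zk)) zj)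

  cactus⇒pieces : Cactus G → ∀ i → Cactus (graph (P i))
  cactus⇒pieces cac i = Sub.cactus⁻¹ i (connected i) cac

  cycle-through-piece : ∀ i (C : Cycle G) {a b} → OnCycle C (embed (P i) a) (embed (P i) b) →
                        ∀ k → Vertices (P i) (Cycle.c C k)
  cycle-through-piece i C onC = OnCycle-⊆ C (Vertices? (P i)) (noReentry i) onC (_ , refl) (_ , refl)

  cycle-unique-in-piece : ∀ i → Cactus (graph (P i)) → ∀ (C D : Cycle G) {a b x y} →
    Adj (graph (P i)) a b →
    OnCycle C (embed (P i) a) (embed (P i) b) → OnCycle D (embed (P i) a) (embed (P i) b) →
    OnCycle C x y → OnCycle D x y
  cycle-unique-in-piece i cacᵢ C D {a} {b} ab onC onD onCxy = pulled-back onCxy (EdgeOf-⊆ inC onCxy)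
    where
    open Sub i
    inC : ∀ k → Vertices (P i) (Cycle.c C k)
    inC = cycle-through-piece i C onC
    inD : ∀ k → Vertices (P i) (Cycle.c D k)
    inD = cycle-through-piece i D onD
    pulled-back : ∀ {x y} → OnCycle C x y → Vertices (P i) x × Vertices (P i) y → OnCycle D x y
    pulled-back onCxy ((x′ , refl) , (y′ , refl)) =
      to (OnCycle-e⁻¹ D inD)
         (proj₁ (proj₂ cacᵢ (cycle-e⁻¹ C inC) (cycle-e⁻¹ D inD) a b ab
                  (from (OnCycle-e⁻¹ C inC) onC) (from (OnCycle-e⁻¹ D inD) onD) x′ y′)
                (from (OnCycle-e⁻¹ C inC) onCxy))

  pieces⇒cactus : Connected G → (∀ i → Cactus (graph (P i))) → Cactus G
  pieces⇒cactus connG cac = connG , λ C D a b ab onC onD x y → unique C D ab onC onD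
    where
    unique : ∀ C D {a b x y} → Adj G a b → OnCycle C a b → OnCycle D a b →
             (OnCycle C x y → OnCycle D x y) × (OnCycle D x y → OnCycle C x y)
    unique C D ab onC onD with covers ab
    ... | i , (a′ , refl) , (b′ , refl) =
      cycle-unique-in-piece i (cac i) C D ab′ onC onD , cycle-unique-in-piece i (cac i) D C ab′ onD onC
      where
      ab′ : Adj (graph (P i)) a′ b′
      ab′ = Sub.Adj-e⁻¹ i ab

module ContractInPiece {n n′} {G : Graph n} {G′ : Graph n′} {u v} (con : Contraction G G′ u v)
  {l} {P : Fin l → Piece n} (sys : BlockSystem G P) (i : Fin l)
  {m′} {H : Graph m′} {a b} (conᵢ : Contraction (graph (P i)) H a b)
  (ea≡u : embed (P i) a ≡ u) (eb≡v : embed (P i) b ≡ v) where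

  open BlockSystem sys
  open BlockSystemProperties sys using (edge-into-overlap⇒≡)
  open ContractionProperties {G = G} {G′ = G′} con hiding (connected)
  module Pᵢ = ContractionProperties {G = graph (P i)} {G′ = H} conᵢ
  open InducedSubgraph {B = graph (P i)} {G = G} (embed-injective i) (induced i) using (Adj-e; Adj-e⁻¹)

  e : Fin (order (P i)) → Fin n
  e = embed (P i)

  -- via an arbitrary preimage under the contraction of piece i; by e′-π the choice does not matter
  e′ : Fin m′ → Fin n′
  e′ c = π (e (proj₁ (Pᵢ.π-surjective c)))

  contracted : Piece n′
  contracted = piece m′ H e′

  projected : Piece n → Piece n′
  projected p = piece (order p) (graph p) (π ∘ embed p)

  P′ : Fin l → Piece n′
  P′ = updateAt (projected ∘ P) i (λ _ → contracted)

  P′-i : P′ i ≡ contracted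
  P′-i = updateAt-updates i (projected ∘ P)

  P′-j : ∀ {j} → j ≢ i → P′ j ≡ projected (P j)
  P′-j {j} = updateAt-minimal j i (projected ∘ P)

  P′-elim : (Φ : Fin l → Piece n′ → Set) → Φ i contracted → (∀ j → j ≢ i → Φ j (projected (P j))) →
            ∀ j → Φ j (P′ j)
  P′-elim Φ Φ-i Φ-j j with j ≟ i
  ... | yes refl = subst (Φ i) (≡.sym P′-i) Φ-i
  ... | no j≢i = subst (Φ j) (≡.sym (P′-j j≢i)) (Φ-j j j≢i)

  Merged⇒i : ∀ {j x y} → Merged x y → Vertices (P j) x → Vertices (P j) y → j ≡ i
  Merged⇒i (inj₁ (refl , refl)) uj vj = sharing-two⇒≡ uj (a , ea≡u) vj (b , eb≡v) (Adj⇒≢ G u~v)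
  Merged⇒i (inj₂ (refl , refl)) vj uj = sharing-two⇒≡ uj (a , ea≡u) vj (b , eb≡v) (Adj⇒≢ G u~v)

  Merged-e : ∀ {x y} → Pᵢ.Merged x y → Merged (e x) (e y)
  Merged-e (inj₁ (refl , refl)) = inj₁ (ea≡u , eb≡v)
  Merged-e (inj₂ (refl , refl)) = inj₂ (eb≡v , ea≡u)

  Merged-e⁻¹ : ∀ {X x} → Merged X (e x) → ∃ λ x′ → e x′ ≡ X × Pᵢ.Merged x′ x
  Merged-e⁻¹ (inj₁ (refl , ex≡v)) = a , ea≡u , inj₁ (refl , embed-injective i _ b (trans ex≡v (≡.sym eb≡v)))
  Merged-e⁻¹ (inj₂ (refl , ex≡u)) = b , eb≡v , inj₂ (refl , embed-injective i _ a (trans ex≡u (≡.sym ea≡u)))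

  e′-π : ∀ x → e′ (Pᵢ.π x) ≡ π (e x)
  e′-π x with Pᵢ.π-≡ (proj₂ (Pᵢ.π-surjective (Pᵢ.π x)))
  ... | inj₁ x′≡x = cong (π ∘ e) x′≡x
  ... | inj₂ m = π-Merged (Merged-e m)

  π-lift : ∀ {X c} → π X ≡ e′ c → ∃ λ x → e x ≡ X × Pᵢ.π x ≡ c
  π-lift {X} {c} πX≡e′c with Pᵢ.π-surjective c
  ... | x₀ , πx₀≡c with π-≡ πX≡e′c
  ...   | inj₁ refl = x₀ , refl , πx₀≡c
  ...   | inj₂ m with Merged-e⁻¹ m
  ...     | x , ex≡X , m′ = x , ex≡X , trans (Pᵢ.π-Merged m′) πx₀≡c

  e′-injective : ∀ c₁ c₂ → e′ c₁ ≡ e′ c₂ → c₁ ≡ c₂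
  e′-injective c₁ c₂ eq with Pᵢ.π-surjective c₁ | Pᵢ.π-surjective c₂
  ... | x₁ , refl | x₂ , refl with π-≡ eq
  ...   | inj₁ ex₁≡ex₂ = cong Pᵢ.π (embed-injective i x₁ x₂ ex₁≡ex₂)
  ...   | inj₂ m with Merged-e⁻¹ m
  ...     | x , ex≡ex₁ , m′ =
    trans (cong Pᵢ.π (embed-injective i x₁ x (≡.sym ex≡ex₁))) (Pᵢ.π-Merged m′)

  e′-induced : ∀ c₁ c₂ → adj H c₁ c₂ ≡ adj G′ (e′ c₁) (e′ c₂)
  e′-induced c₁ c₂ = Bool.⇔→≡ (mk⇔ forth back)
    where
    forth : Adj H c₁ c₂ → Adj G′ (e′ c₁) (e′ c₂)
    forth h with Pᵢ.Adj′⇒ h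
    ... | c₁≢c₂ , x , y , refl , refl , xy =
      ⇒Adj′ (c₁≢c₂ ∘ e′-injective _ _ , e x , e y , ≡.sym (e′-π x) , ≡.sym (e′-π y) , Adj-e xy)
    back : Adj G′ (e′ c₁) (e′ c₂) → Adj H c₁ c₂
    back h with Adj′⇒ h
    ... | e′c₁≢e′c₂ , X , Y , πX , πY , XY with π-lift πX | π-lift πY
    ...   | x , refl , πx≡c₁ | y , refl , πy≡c₂ =
      Pᵢ.⇒Adj′ (e′c₁≢e′c₂ ∘ cong e′ , x , y , πx≡c₁ , πy≡c₂ , Adj-e⁻¹ XY)

  module Projected {j} (j≢i : j ≢ i) where
    eⱼ : Fin (order (P j)) → Fin n
    eⱼ = embed (P j)

    π∘eⱼ-injective : ∀ c₁ c₂ → π (eⱼ c₁) ≡ π (eⱼ c₂) → c₁ ≡ c₂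
    π∘eⱼ-injective c₁ c₂ eq with π-≡ eq
    ... | inj₁ eq′ = embed-injective j c₁ c₂ eq′
    ... | inj₂ m = ⊥-elim (j≢i (Merged⇒i m (c₁ , refl) (c₂ , refl)))

    -- a merged endpoint outside piece j would give a walk re-entering piece j
    π∘eⱼ-induced : ∀ c₁ c₂ → adj (graph (P j)) c₁ c₂ ≡ adj G′ (π (eⱼ c₁)) (π (eⱼ c₂))
    π∘eⱼ-induced c₁ c₂ = Bool.⇔→≡ (mk⇔ forth back)
      where
      p q : Fin n
      p = eⱼ c₁
      q = eⱼ c₂
      open InducedSubgraph {B = graph (P j)} {G = G} (embed-injective j) (induced j)
        renaming (Adj-e to Adj-eⱼ; Adj-e⁻¹ to Adj-eⱼ⁻¹)
      outside : ∀ {y z} → Merged y z → Vertices (P j) z → ¬ Vertices (P j) y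
      outside m zj yj = j≢i (Merged⇒i m yj zj)
      forth : Adj (graph (P j)) c₁ c₂ → Adj G′ (π p) (π q)
      forth h = Adj-π pq πp≢πq
        where
        pq : Adj G p q
        pq = Adj-eⱼ h
        πp≢πq : π p ≢ π q
        πp≢πq eq with π-≡ eq
        ... | inj₁ p≡q = Adj⇒≢ G pq p≡q
        ... | inj₂ m = j≢i (Merged⇒i m (c₁ , refl) (c₂ , refl))
      back : Adj G′ (π p) (π q) → Adj (graph (P j)) c₁ c₂
      back h with Adj′⇒ h
      ... | πp≢πq , x , y , πx , πy , xy with π-≡ πx | π-≡ πy
      ...   | inj₁ refl | inj₁ refl = Adj-eⱼ⁻¹ xy
      ...   | inj₁ refl | inj₂ m = ⊥-elim (noReentry j (c₂ , refl) (outside m (c₂ , refl))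
              (Adj-sym G (Merged⇒Adj m))
              (there (Merged⇒≢ m) (Adj-sym G xy) (here (πp≢πq ∘ cong π))) (c₁ , refl))
      ...   | inj₂ m | inj₁ refl = ⊥-elim (noReentry j (c₁ , refl) (outside m (c₁ , refl))
              (Adj-sym G (Merged⇒Adj m))
              (there (Merged⇒≢ m) xy (here (πp≢πq ∘ ≡.sym ∘ cong π))) (c₂ , refl))
      ...   | inj₂ m | inj₂ m′ =
              ⊥-elim (πp≢πq (trans (π-merged (Merged-sym m)) (≡.sym (π-merged (Merged-sym m′)))))

  π-Image : Fin l → VSet n′
  π-Image j y′ = ∃ λ x → Vertices (P j) x × π x ≡ y′

  Vertices-P′ : ∀ j → Vertices (P′ j) ≐ π-Image j
  Vertices-P′ = P′-elim (λ j p → Vertices p ≐ π-Image j)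
    ((λ { _ (c , refl) → e _ , (_ , refl) , refl }) ,
     (λ { _ (_ , (x , refl) , refl) → Pᵢ.π x , e′-π x }))
    (λ j _ → (λ { _ (c , refl) → embed (P j) c , (c , refl) , refl }) ,
             (λ { _ (_ , (c , refl) , refl) → c , refl }))

  covers′ : ∀ {x′ y′} → Adj G′ x′ y′ → ∃ λ j → π-Image j x′ × π-Image j y′
  covers′ h with Adj′⇒ h
  ... | _ , x , y , πx , πy , xy with covers xy
  ...   | j , xj , yj = j , (x , xj , πx) , (y , yj , πy)

  sharing-two⇒≡′ : ∀ {j k x′ y′} → π-Image j x′ → π-Image k x′ → π-Image j y′ → π-Image k y′ →
                   x′ ≢ y′ → j ≡ k
  sharing-two⇒≡′ (x₁ , x₁j , refl) (x₂ , x₂k , πx₂) (y₁ , y₁j , refl) (y₂ , y₂k , πy₂) x′≢y′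
    with π-≡ (≡.sym πx₂) | π-≡ (≡.sym πy₂)
  ... | inj₁ refl | inj₁ refl = sharing-two⇒≡ x₁j x₂k y₁j y₂k (x′≢y′ ∘ cong π)
  ... | inj₁ refl | inj₂ m =
    edge-into-overlap⇒≡ (Merged⇒Adj m) y₁j y₂k x₁j x₂k (x′≢y′ ∘ cong π)
      (λ x₁≡y₂ → x′≢y′ (trans (cong π x₁≡y₂) πy₂))
  ... | inj₂ m | inj₁ refl =
    edge-into-overlap⇒≡ (Merged⇒Adj m) x₁j x₂k y₁j y₂k (x′≢y′ ∘ ≡.sym ∘ cong π)
      (λ y₁≡x₂ → x′≢y′ (≡.sym (trans (cong π y₁≡x₂) πx₂)))
  ... | inj₂ m | inj₂ m′ = ⊥-elim (x′≢y′ (trans (π-merged m) (≡.sym (π-merged m′))))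

  -- a walk re-entering the image of piece j lifts to one re-entering piece j
  noReentry′ : ∀ j → NoReentry G′ (π-Image j)
  noReentry′ j (p , pj , refl) q′∉ pq′ w (r , rj , refl) with Adj′⇒ pq′
  ... | _ , x , y , πx , πy , xy = reenter (Vertices? (P j) x)
    where
    y∉ : ¬ Vertices (P j) y
    y∉ yj = q′∉ (y , yj , πy)
    w↑ : Reach G (λ z → π z ≢ π p) y r
    w↑ = Reach-lift w πy refl
    reenter : Dec (Vertices (P j) x) → ⊥
    reenter (yes xj) =
      noReentry j xj y∉ xy (Reach-mono (λ z πz≢πp z≡x → πz≢πp (trans (cong π z≡x) πx)) w↑) rj
    reenter (no x∉) with π-≡ πx
    ... | inj₁ refl = x∉ pj
    ... | inj₂ m = noReentry j pj x∉ (Adj-sym G (Merged⇒Adj m))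
                     (there (Merged⇒≢ m) xy (Reach-mono (λ z πz≢πp → πz≢πp ∘ cong π) w↑)) rj

  system′ : BlockSystem G′ P′
  system′ = record
    { embed-injective = P′-elim (λ _ p → ∀ a b → embed p a ≡ embed p b → a ≡ b)
                                e′-injective (λ _ → Projected.π∘eⱼ-injective)
    ; induced         = P′-elim (λ _ p → ∀ a b → adj (graph p) a b ≡ adj G′ (embed p a) (embed p b))
                                e′-induced (λ _ → Projected.π∘eⱼ-induced)
    ; connected       = P′-elim (λ _ p → Connected (graph p))
                                (Pᵢ.connected (connected i)) (λ j _ → connected j)
    ; covers          = λ h → let (j , xj , yj) = covers′ h
                              in j , from′ j xj , from′ j yj
    ; sharing-two⇒≡   = λ {j} {k} xj xk yj yk →
                          sharing-two⇒≡′ (to′ j xj) (to′ k xk) (to′ j yj) (to′ k yk)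
    ; noReentry       = λ j → NoReentry-resp-≐ (swap (Vertices-P′ j)) (noReentry′ j)
    }
    where
    to′ : ∀ j {y′} → Vertices (P′ j) y′ → π-Image j y′
    to′ j = proj₁ (Vertices-P′ j) _
    from′ : ∀ j {y′} → π-Image j y′ → Vertices (P′ j) y′
    from′ j = proj₂ (Vertices-P′ j) _

≤-sumFin : ∀ {l} (ks : Fin l → ℕ) i → ks i ≤ sumFin l ks
≤-sumFin ks zero = ℕ.m≤m+n _ _
≤-sumFin ks (suc i) = ℕ.≤-trans (≤-sumFin (ks ∘ suc) i) (ℕ.m≤n+m _ (ks zero))

sumFin-0 : ∀ l → sumFin l (λ _ → 0) ≡ 0
sumFin-0 zero = refl
sumFin-0 (suc l) = sumFin-0 l

sumFin-updateAt-suc : ∀ {l} (ks : Fin l → ℕ) i → sumFin l (updateAt ks i suc) ≡ suc (sumFin l ks)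
sumFin-updateAt-suc ks zero = refl
sumFin-updateAt-suc ks (suc i) = trans (cong (ks zero +_) (sumFin-updateAt-suc (ks ∘ suc) i)) (ℕ.+-suc _ _)

sumFin-updateAt-pred : ∀ {l} (ks : Fin l → ℕ) i {k} → ks i ≡ suc k →
                       suc (sumFin l (updateAt ks i λ _ → k)) ≡ sumFin l ks
sumFin-updateAt-pred {suc l} ks zero ks0≡1+k = cong (_+ sumFin l (ks ∘ suc)) (≡.sym ks0≡1+k)
sumFin-updateAt-pred ks (suc i) ksi≡1+k =
  trans (≡.sym (ℕ.+-suc (ks zero) _)) (cong (ks zero +_) (sumFin-updateAt-pred (ks ∘ suc) i ksi≡1+k))

record ContractionStep {n} (k : ℕ) (G : Graph n) : Set where
  constructor contraction-step
  field
    k′          : ℕ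
    k≡1+k′      : k ≡ suc k′
    order′      : ℕ
    contracted  : Graph order′
    u v         : Fin n
    contraction : Contraction G contracted u v
    rest        : KContractible k′ contracted

first-step : ∀ {n k} {G : Graph n} → KContractible k G → Cactus G ⊎ ContractionStep k G
first-step (done cac) = inj₁ cac
first-step (step con D) = inj₂ (contraction-step _ refl _ _ _ _ con D)

all⊎any : ∀ {l} {A B : Fin l → Set} → (∀ i → A i ⊎ B i) → (∀ i → A i) ⊎ ∃ B
all⊎any {zero} _ = inj₁ λ ()
all⊎any {suc l} A⊎B with A⊎B zero | all⊎any (A⊎B ∘ suc)
... | inj₂ b | _ = inj₂ (zero , b)
... | inj₁ _ | inj₂ (i , b) = inj₂ (suc i , b)
... | inj₁ a | inj₁ as = inj₁ λ { zero → a ; (suc i) → as i }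

pieces⇒contractible : ∀ k {n} {G : Graph n} {l} {P : Fin l → Piece n} → BlockSystem G P → Connected G →
                      ∀ {ks} → sumFin l ks ≤ k → (∀ i → KContractible (ks i) (graph (P i))) →
                      KContractible k G
pieces⇒contractible k {G = G} sys connG {ks} Σks≤k D with all⊎any (first-step ∘ D)
... | inj₁ cactus = done (BlockSystemProperties.pieces⇒cactus sys connG cactus)
... | inj₂ (i , contraction-step k′ ksi≡1+k′ _ H a b conᵢ rest) = contract k Σks≤k
  where
  open BlockSystemProperties sys using (module Sub)
  ks′ : Fin _ → ℕ
  ks′ = updateAt ks i λ _ → k′
  contract : ∀ k → sumFin _ ks ≤ k → KContractible k G
  contract zero Σks≤0 =
    case ℕ.≤-trans (ℕ.≤-reflexive (≡.sym ksi≡1+k′)) (ℕ.≤-trans (≤-sumFin ks i) Σks≤0) of λ ()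
  contract (suc k) Σks≤1+k with contract-edge G (Sub.Adj-e i (proj₁ conᵢ))
  ... | _ , G′ , con =
    step con (pieces⇒contractible k C.system′ (ContractionProperties.connected con connG) Σks′≤k D′)
    where
    module C = ContractInPiece {G = G} {G′ = G′} con sys i {H = H} conᵢ refl refl
    Σks′≤k : sumFin _ ks′ ≤ k
    Σks′≤k = ℕ.≤-pred (ℕ.≤-trans (ℕ.≤-reflexive (sumFin-updateAt-pred ks i ksi≡1+k′)) Σks≤1+k)
    D′ : ∀ j → KContractible (ks′ j) (graph (C.P′ j))
    D′ = C.P′-elim (λ j p → KContractible (ks′ j) (graph p))
      (subst (λ k → KContractible k H) (≡.sym (updateAt-updates i ks)) rest)
      (λ j j≢i → subst (λ k → KContractible k _) (≡.sym (updateAt-minimal j i ks j≢i)) (D j))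

contractible⇒pieces : ∀ {k n} {G : Graph n} → KContractible k G →
                      ∀ {l} {P : Fin l → Piece n} → BlockSystem G P → Connected G →
                      Σ (Fin l → ℕ) λ ks → sumFin l ks ≤ k × (∀ i → KContractible (ks i) (graph (P i)))
contractible⇒pieces {k} (done cac) {l} sys _ =
  (λ _ → 0) , subst (_≤ k) (≡.sym (sumFin-0 l)) z≤n ,
  done ∘ BlockSystemProperties.cactus⇒pieces sys cac
contractible⇒pieces {G = G} (step {H = G′} con D) {l} {P} sys connG with BlockSystem.covers sys (proj₁ con)
... | i , (a , refl) , (b , refl) with contract-edge (graph (P i)) (Sub.Adj-e⁻¹ i (proj₁ con))
  where open BlockSystemProperties sys using (module Sub)
... | _ , H , conᵢ = distribute (contractible⇒pieces D C.system′ (ContractionProperties.connected con connG))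
  where
  module C = ContractInPiece {G = G} {G′ = G′} con sys i {H = H} conᵢ refl refl
  distribute : (Σ (Fin l → ℕ) λ ks → sumFin l ks ≤ _ × (∀ j → KContractible (ks j) (graph (C.P′ j)))) →
               Σ (Fin l → ℕ) λ ks → sumFin l ks ≤ _ × (∀ j → KContractible (ks j) (graph (P j)))
  distribute (ks′ , Σks′≤k , D′) = updateAt ks′ i suc ,
    ℕ.≤-trans (ℕ.≤-reflexive (sumFin-updateAt-suc ks′ i)) (s≤s Σks′≤k) , D″
    where
    D″ : ∀ j → KContractible (updateAt ks′ i suc j) (graph (P j))
    D″ j with j ≟ i
    ... | yes refl = subst (λ k → KContractible k _) (≡.sym (updateAt-updates i ks′))
                           (step conᵢ (subst (KContractible _ ∘ graph) C.P′-i (D′ i)))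
    ... | no j≢i = subst₂ (λ k p → KContractible k (graph p))
                          (≡.sym (updateAt-minimal j i ks′ j≢i)) (C.P′-j j≢i) (D′ j)

module Blocks {n} (G : Graph n) {l} {m : Fin l → ℕ} (B : (i : Fin l) → Graph (m i))
  (e : (i : Fin l) → Fin (m i) → Fin n)
  (embedding : ∀ i → IsBlockEmbedding G (B i) (e i))
  (complete : ∀ S → IsBlock G S → ∃ λ i → S ≐ Image (e i))
  (distinct : ∀ i j → Image (e i) ≐ Image (e j) → i ≡ j) where

  pieces : Fin l → Piece n
  pieces i = piece (m i) (B i) (e i)

  block : ∀ i → IsBlock G (Image (e i))
  block = proj₂ ∘ proj₂ ∘ embedding

  -- the conclusion is decidable, so the hull of xy may be assumed decidable, hence a block
  covers : ∀ {x y} → Adj G x y → ∃ λ i → Image (e i) x × Image (e i) y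
  covers {x} {y} xy = decidable-stable (any? λ i → Vertices? (pieces i) x ×-dec Vertices? (pieces i) y)
    (¬¬-map (in-block ∘ complete Hull ∘ Hull-block) (¬¬-decidable Hull))
    where
    open EdgeHull {G = G} xy
    in-block : (∃ λ i → Hull ≐ Image (e i)) → ∃ λ i → Image (e i) x × Image (e i) y
    in-block (i , Hull⊆eᵢ , _) = i , Hull⊆eᵢ x Hull-x , Hull⊆eᵢ y Hull-y

  block-system : BlockSystem G pieces
  block-system = record
    { embed-injective = proj₁ ∘ embedding
    ; induced         = proj₁ ∘ proj₂ ∘ embedding
    ; connected       = λ i → InducedSubgraph.connected⁻¹ {B = B i} {G = G}
                                (proj₁ (embedding i)) (proj₁ (proj₂ (embedding i))) (proj₁ (proj₁ (block i)))
    ; covers          = covers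
    ; sharing-two⇒≡   = λ {i} {j} xi xj yi yj x≢y →
                          distinct i j (blocks-share-≤1 (block i) (block j) xi xj yi yj x≢y)
    ; noReentry       = block-noReentry ∘ block
    }

lemma14 : ∀ {n} (G : Graph n) (k : ℕ) → Connected G →
    (l : ℕ) (m : Fin l → ℕ) (B : (i : Fin l) → Graph (m i))
    (e : (i : Fin l) → Fin (m i) → Fin n) →
    (∀ i → IsBlockEmbedding G (B i) (e i)) →
    (∀ S → IsBlock G S → ∃ λ i → S ≐ Image (e i)) →
    (∀ i j → Image (e i) ≐ Image (e j) → i ≡ j) →
    KContractible k G ⇔
      (Σ (Fin l → ℕ) λ ks → sumFin l ks ≤ k × (∀ i → KContractible (ks i) (B i)))
lemma14 G k connG l m B e embedding complete distinct =
  mk⇔ (λ D → contractible⇒pieces D block-system connG)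
      (λ (ks , Σks≤k , D) → pieces⇒contractible k block-system connG Σks≤k D)
  where open Blocks G B e embedding complete distinct using (block-system)
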